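{- Let $\mathcal{M}=(V,E,F)$ be a finite map (a $2$-cell embedding of a finite connected graph, with vertex set $V$, edge set $E$ and face set $F$, into a closed surface) with Euler characteristic $\chi(\mathcal{M})=|V|-|E|+|F|$. Assume that every vertex of $\mathcal{M}$ has valency $\ell$ and every face of $\mathcal{M}$ has length $k$, and that $\gcd(\chi(\mathcal{M}),|E|)=1$. Then $|E|$ divides $k\ell$, $|V|$ divides $2k$, and $|F|$ divides $2\ell$.
   Context: The valency of a vertex is the number of edges incident with it; the length of a face is the number of edges incident with it. Maps are assumed to have no loops, so each edge is incident with exactly two vertices and exactly two faces. -}

module Defs where

open import Data.Nat using (ℕ)
open import Data.Fin using (Fin; _≟_)
open import Data.Fin.Properties using (any?)
open import Data.List using (List; length; filter; allFin)
open import Data.Product using (_×_; ∃; _,_)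
open import Data.Product.Properties using ()
open import Relation.Nullary.Decidable using (_×-dec_)
open import Data.Sum using (_⊎_)
open import Data.Integer using (ℤ; +_; _-_; _+_)
open import Relation.Binary.PropositionalEquality using (_≡_; _≢_)
open import Relation.Binary.Construct.Closure.ReflexiveTransitive using (Star)
open import Function.Bundles using (_⇔_)

Step₂ : ∀ {n} → (Fin n → Fin n) → (Fin n → Fin n) → Fin n → Fin n → Set
Step₂ f g x y = (y ≡ f x) ⊎ (y ≡ g x)

Step₃ : ∀ {n} → (Fin n → Fin n) → (Fin n → Fin n) → (Fin n → Fin n) → Fin n → Fin n → Set
Step₃ f g h x y = (y ≡ f x) ⊎ ((y ≡ g x) ⊎ (y ≡ h x))

-- A finite map (2-cell embedding of a finite connected graph into a closed
-- surface, orientable or not), presented by its flags (as in Jones–Singerman /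
-- Bryant–Singerman): a finite flag set with three fixed-point-free involutions
-- r0, r1, r2 such that r0 r2 = r2 r0 is fixed-point-free, and the group
-- ⟨r0,r1,r2⟩ acts transitively.  Vertices, edges and faces are the orbits of
-- ⟨r1,r2⟩, ⟨r0,r2⟩, ⟨r0,r1⟩ respectively; they are given here as finite sets
-- Fin nV, Fin nE, Fin nF together with surjective labellings of the flags
-- whose fibres are exactly those orbits.
record Map : Set where
  field
    nFlags nV nE nF : ℕ
    r0 r1 r2 : Fin nFlags → Fin nFlags
    r0-inv : ∀ x → r0 (r0 x) ≡ x
    r1-inv : ∀ x → r1 (r1 x) ≡ x
    r2-inv : ∀ x → r2 (r2 x) ≡ x
    r0-fpf : ∀ x → r0 x ≢ x
    r1-fpf : ∀ x → r1 x ≢ x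
    r2-fpf : ∀ x → r2 x ≢ x
    r0r2-comm : ∀ x → r0 (r2 x) ≡ r2 (r0 x)
    r0r2-fpf : ∀ x → r0 (r2 x) ≢ x
    connected : ∀ x y → Star (Step₃ r0 r1 r2) x y
    vert : Fin nFlags → Fin nV
    edge : Fin nFlags → Fin nE
    face : Fin nFlags → Fin nF
    vert-surj : ∀ v → ∃ λ x → vert x ≡ v
    edge-surj : ∀ e → ∃ λ x → edge x ≡ e
    face-surj : ∀ f → ∃ λ x → face x ≡ f
    vert-orbit : ∀ x y → (vert x ≡ vert y) ⇔ Star (Step₂ r1 r2) x y
    edge-orbit : ∀ x y → (edge x ≡ edge y) ⇔ Star (Step₂ r0 r2) x y
    face-orbit : ∀ x y → (face x ≡ face y) ⇔ Star (Step₂ r0 r1) x y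

  VertEdgeInc : Fin nV → Fin nE → Set
  VertEdgeInc v e = ∃ λ x → (vert x ≡ v) × (edge x ≡ e)

  FaceEdgeInc : Fin nF → Fin nE → Set
  FaceEdgeInc f e = ∃ λ x → (face x ≡ f) × (edge x ≡ e)

  valency : Fin nV → ℕ
  valency v = length (filter (λ e → any? (λ x → (vert x ≟ v) ×-dec (edge x ≟ e))) (allFin nE))

  faceLength : Fin nF → ℕ
  faceLength f = length (filter (λ e → any? (λ x → (face x ≟ f) ×-dec (edge x ≟ e))) (allFin nE))

  χ : ℤ
  χ = (+ nV - + nE) + + nF

-- Standing assumption of the paper: no loops, so each edge is incident with
-- exactly two (distinct) vertices and exactly two (distinct) faces.
-- r0 moves a flag to the other end of its edge; r2 to the other side.
NoLoops : Map → Set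
NoLoops M = ∀ x → vert x ≢ vert (r0 x)
  where open Map M

EdgesTwoFaces : Map → Set
EdgesTwoFaces M = ∀ x → face x ≢ face (r2 x)
  where open Map M

{-# OPTIONS --safe #-}
-- Counting vertex–edge incidences edge by edge, each edge has exactly two ends since there
-- are no loops, so |V| ℓ = 2|E|; the same count in the dual map gives |F| k = 2|E|.
-- Substituting these into χ k ℓ = |V| ℓ k − |E| k ℓ + |F| k ℓ gives
-- χ k ℓ = |E| (2k + 2ℓ − k ℓ), so gcd (χ, |E|) = 1 forces |E| ∣ k ℓ. Then |V| ℓ = 2|E|
-- divides 2 k ℓ, and cancelling ℓ gives |V| ∣ 2k; symmetrically |F| ∣ 2ℓ.
module Submission where

open import Defs
open import Data.Nat using (ℕ; zero; suc; NonZero; ≢-nonZero)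
open import Data.Nat.Properties
  using (+-0-commutativeMonoid; *-assoc; *-comm; m*n≢0; m*n≢0⇒n≢0)
open import Data.Nat.Divisibility
  using (_∣_; m∣m*n; *-monoʳ-∣; *-cancelʳ-∣; module ∣-Reasoning)
open import Data.Nat.Coprimality using (gcd≡1⇒coprime)
open import Data.Fin using (Fin; zero; suc; _≟_; punchIn)
open import Data.Fin.Properties using (any?; punchInᵢ≢i)
import Data.Integer as ℤ
open ℤ using (+_; ∣_∣)
open import Data.Integer.Properties using (pos-*; abs-*; +-injective)
open import Data.Integer.GCD using (gcd; gcd-comm; gcd[0,0]≡0)
open import Data.Integer.Coprimality using (Coprime; coprime-divisor)
open import Data.Integer.Tactic.RingSolver using (solve-∀)
open import Data.List using (length; filter; allFin; tabulate)
open import Data.Product using (_×_; _,_; proj₁; proj₂)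
open import Data.Sum as Sum using (_⊎_; inj₁; inj₂; swap)
open import Function using (_∘_; _⇔_; mk⇔; Equivalence)
open import Relation.Nullary using (Dec; yes; no; ¬_; contradiction)
open import Relation.Nullary.Decidable using (_⊎-dec_; _×-dec_)
open import Relation.Unary using (Pred; Decidable)
open import Relation.Binary.PropositionalEquality
open import Relation.Binary.Construct.Closure.ReflexiveTransitive as Star using (Star; ε; _◅_)
open import Algebra.Properties.CommutativeMonoid.Sum +-0-commutativeMonoid
  using (sum-syntax; sum-cong-≗; sum-remove; sum-replicate-zero; ∑-distrib-+; ∑-comm)

module _ where
  open ℤ using (ℤ; _+_; _-_; _*_)

  [v-e+f]*[k*l]≡e*[2k+2l-k*l] : ∀ (v e f k l : ℤ) → v * l ≡ + 2 * e → f * k ≡ + 2 * e →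
                                 ((v - e) + f) * (k * l) ≡ e * ((+ 2 * k + + 2 * l) - k * l)
  [v-e+f]*[k*l]≡e*[2k+2l-k*l] v e f k l vl≡2e fk≡2e = begin
    ((v - e) + f) * (k * l)                        ≡⟨ expand v e f k l ⟩
    ((v * l) * k - e * (k * l)) + (f * k) * l      ≡⟨ cong₂ (λ a b → (a * k - e * (k * l)) + b * l)
                                                            vl≡2e fk≡2e ⟩
    ((+ 2 * e) * k - e * (k * l)) + (+ 2 * e) * l  ≡⟨ collect e k l ⟩
    e * ((+ 2 * k + + 2 * l) - k * l)              ∎
    where
    open ≡-Reasoning
    expand : ∀ v e f k l → ((v - e) + f) * (k * l) ≡ ((v * l) * k - e * (k * l)) + (f * k) * l
    expand = solve-∀
    collect : ∀ e k l →
              ((+ 2 * e) * k - e * (k * l)) + (+ 2 * e) * l ≡ e * ((+ 2 * k + + 2 * l) - k * l)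
    collect = solve-∀

open import Data.Nat using (_+_; _*_)

𝟙 : ∀ {p} {P : Set p} → Dec P → ℕ
𝟙 (yes _) = 1
𝟙 (no _)  = 0

𝟙-yes : ∀ {p} {P : Set p} → P → (P? : Dec P) → 𝟙 P? ≡ 1
𝟙-yes p (yes _) = refl
𝟙-yes p (no ¬p) = contradiction p ¬p

𝟙-no : ∀ {p} {P : Set p} → ¬ P → (P? : Dec P) → 𝟙 P? ≡ 0
𝟙-no ¬p (yes p) = contradiction p ¬p
𝟙-no ¬p (no _)  = refl

𝟙-cong : ∀ {p q} {P : Set p} {Q : Set q} → P ⇔ Q → (P? : Dec P) (Q? : Dec Q) →
         𝟙 P? ≡ 𝟙 Q?
𝟙-cong P⇔Q P? (yes q) = 𝟙-yes (Equivalence.from P⇔Q q) P?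
𝟙-cong P⇔Q P? (no ¬q) = 𝟙-no (¬q ∘ Equivalence.to P⇔Q) P?

𝟙-⊎ : ∀ {p q} {P : Set p} {Q : Set q} → ¬ (P × Q) → (P? : Dec P) (Q? : Dec Q) →
      𝟙 (P? ⊎-dec Q?) ≡ 𝟙 P? + 𝟙 Q?
𝟙-⊎ disjoint (yes p) (yes q) = contradiction (p , q) disjoint
𝟙-⊎ disjoint (yes _) (no _)  = refl
𝟙-⊎ disjoint (no _)  (yes _) = refl
𝟙-⊎ disjoint (no _)  (no _)  = refl

∑-const : ∀ n c → ∑[ i < n ] c ≡ n * c
∑-const zero    c = refl
∑-const (suc n) c = cong (_+_ c) (∑-const n c)

∑-regular : ∀ {n} (d : Fin n → ℕ) {c s} → (∀ i → d i ≡ c) → ∑[ i < n ] d i ≡ s → n * c ≡ s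
∑-regular {n} d {c} d≡c ∑d≡s = trans (sym (∑-const n c)) (trans (sum-cong-≗ (sym ∘ d≡c)) ∑d≡s)

∑-𝟙-≟ : ∀ {n} (a : Fin n) → ∑[ i < n ] 𝟙 (i ≟ a) ≡ 1
∑-𝟙-≟ {suc n} a = begin
  ∑[ i < suc n ] 𝟙 (i ≟ a)                    ≡⟨ sum-remove {i = a} (λ i → 𝟙 (i ≟ a)) ⟩
  𝟙 (a ≟ a) + ∑[ j < n ] 𝟙 (punchIn a j ≟ a)  ≡⟨ cong₂ _+_ (𝟙-yes refl (a ≟ a)) others ⟩
  1 + 0                                        ∎
  where
  open ≡-Reasoning
  others : ∑[ j < n ] 𝟙 (punchIn a j ≟ a) ≡ 0
  others = trans (sum-cong-≗ (λ j → 𝟙-no (punchInᵢ≢i a j) (punchIn a j ≟ a)))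
                 (sum-replicate-zero n)

length-filter-tabulate : ∀ {a p} {A : Set a} {P : Pred A p} (P? : Decidable P) {n}
                         (f : Fin n → A) →
                         length (filter P? (tabulate f)) ≡ ∑[ i < n ] 𝟙 (P? (f i))
length-filter-tabulate P? {zero}  f = refl
length-filter-tabulate P? {suc n} f with P? (f zero)
... | yes _ = cong suc (length-filter-tabulate P? (f ∘ suc))
... | no _  = length-filter-tabulate P? (f ∘ suc)

handshake : ∀ {m n r} {R : Fin m → Fin n → Set r} (R? : ∀ i j → Dec (R i j))
            (end₁ end₂ : Fin n → Fin m) → (∀ j → end₁ j ≢ end₂ j) →
            (∀ i j → R i j ⇔ (i ≡ end₁ j ⊎ i ≡ end₂ j)) →
            ∑[ i < m ] length (filter (R? i) (allFin n)) ≡ 2 * n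
handshake {m} {n} R? end₁ end₂ distinct R⇔ends = begin
  ∑[ i < m ] length (filter (R? i) (allFin n))
    ≡⟨ sum-cong-≗ (λ i → length-filter-tabulate (R? i) (λ j → j)) ⟩
  ∑[ i < m ] ∑[ j < n ] 𝟙 (R? i j)
    ≡⟨ ∑-comm (λ i j → 𝟙 (R? i j)) ⟩
  ∑[ j < n ] ∑[ i < m ] 𝟙 (R? i j)
    ≡⟨ sum-cong-≗ two-ends ⟩
  ∑[ j < n ] 2
    ≡⟨ ∑-const n 2 ⟩
  n * 2
    ≡⟨ *-comm n 2 ⟩
  2 * n ∎
  where
  open ≡-Reasoning
  two-ends : ∀ j → ∑[ i < m ] 𝟙 (R? i j) ≡ 2
  two-ends j = begin
    ∑[ i < m ] 𝟙 (R? i j)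
      ≡⟨ sum-cong-≗ (λ i → 𝟙-cong (R⇔ends i j) (R? i j) (end? i)) ⟩
    ∑[ i < m ] 𝟙 (end? i)
      ≡⟨ sum-cong-≗ (λ i → 𝟙-⊎ disjoint (i ≟ end₁ j) (i ≟ end₂ j)) ⟩
    ∑[ i < m ] (𝟙 (i ≟ end₁ j) + 𝟙 (i ≟ end₂ j))
      ≡⟨ ∑-distrib-+ (λ i → 𝟙 (i ≟ end₁ j)) (λ i → 𝟙 (i ≟ end₂ j)) ⟩
    ∑[ i < m ] 𝟙 (i ≟ end₁ j) + ∑[ i < m ] 𝟙 (i ≟ end₂ j)
      ≡⟨ cong₂ _+_ (∑-𝟙-≟ (end₁ j)) (∑-𝟙-≟ (end₂ j)) ⟩
    2 ∎
    where
    end? : ∀ i → Dec (i ≡ end₁ j ⊎ i ≡ end₂ j)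
    end? i = i ≟ end₁ j ⊎-dec i ≟ end₂ j
    disjoint : ∀ {i} → ¬ (i ≡ end₁ j × i ≡ end₂ j)
    disjoint (i≡end₁ , i≡end₂) = distinct j (trans (sym i≡end₁) i≡end₂)

dual : Map → Map
dual M = record
  { nFlags = nFlags ; nV = nF ; nE = nE ; nF = nV
  ; r0 = r2 ; r1 = r1 ; r2 = r0
  ; r0-inv = r2-inv ; r1-inv = r1-inv ; r2-inv = r0-inv
  ; r0-fpf = r2-fpf ; r1-fpf = r1-fpf ; r2-fpf = r0-fpf
  ; r0r2-comm = λ x → sym (r0r2-comm x)
  ; r0r2-fpf = λ x r2r0x≡x → r0r2-fpf x (trans (r0r2-comm x) r2r0x≡x)
  ; connected = λ x y → Star.map reverse₃ (connected x y)
  ; vert = face ; edge = edge ; face = vert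
  ; vert-surj = face-surj ; edge-surj = edge-surj ; face-surj = vert-surj
  ; vert-orbit = λ x y → swap-orbit (face-orbit x y)
  ; edge-orbit = λ x y → swap-orbit (edge-orbit x y)
  ; face-orbit = λ x y → swap-orbit (vert-orbit x y)
  }
  where
  open Map M
  reverse₃ : ∀ {x y} → Step₃ r0 r1 r2 x y → Step₃ r2 r1 r0 x y
  reverse₃ (inj₁ y≡r0x)        = inj₂ (inj₂ y≡r0x)
  reverse₃ (inj₂ (inj₁ y≡r1x)) = inj₂ (inj₁ y≡r1x)
  reverse₃ (inj₂ (inj₂ y≡r2x)) = inj₁ y≡r2x
  swap-orbit : ∀ {f g : Fin nFlags → Fin nFlags} {x y} {P : Set} →
               P ⇔ Star (Step₂ f g) x y → P ⇔ Star (Step₂ g f) x y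
  swap-orbit P⇔orbit =
    mk⇔ (Star.map swap ∘ Equivalence.to P⇔orbit) (Equivalence.from P⇔orbit ∘ Star.map swap)

module _ (M : Map) where
  open Map M

  vert-r2 : ∀ x → vert (r2 x) ≡ vert x
  vert-r2 x = Equivalence.from (vert-orbit (r2 x) x) (inj₂ (sym (r2-inv x)) ◅ ε)

  edge-r0 : ∀ x → edge (r0 x) ≡ edge x
  edge-r0 x = Equivalence.from (edge-orbit (r0 x) x) (inj₁ (sym (r0-inv x)) ◅ ε)

  -- The flags of the edge of x are the ⟨r0, r2⟩-orbit {x, r2 x, r0 x, r2 (r0 x)}: the dart
  -- {x, r2 x} at one end and the dart {r0 x, r2 (r0 x)} at the other.
  SameDart : Fin nFlags → Fin nFlags → Set
  SameDart x y = y ≡ x ⊎ y ≡ r2 x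

  sameDart-r2 : ∀ {x y} → SameDart (r2 x) y → SameDart x y
  sameDart-r2     (inj₁ y≡r2x)   = inj₂ y≡r2x
  sameDart-r2 {x} (inj₂ y≡r2r2x) = inj₁ (trans y≡r2r2x (r2-inv x))

  sameDart⇒vert≡ : ∀ {x y} → SameDart x y → vert y ≡ vert x
  sameDart⇒vert≡     (inj₁ refl) = refl
  sameDart⇒vert≡ {x} (inj₂ refl) = vert-r2 x

  edge-orbit⇒sameDart : ∀ {x y} → Star (Step₂ r0 r2) x y → SameDart x y ⊎ SameDart (r0 x) y
  edge-orbit⇒sameDart         ε                = inj₁ (inj₁ refl)
  edge-orbit⇒sameDart {x} {y} (inj₁ refl ◅ xs) =
    swap (Sum.map₂ (subst (λ z → SameDart z y) (r0-inv x)) (edge-orbit⇒sameDart xs))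
  edge-orbit⇒sameDart {x} {y} (inj₂ refl ◅ xs) =
    Sum.map sameDart-r2 (sameDart-r2 ∘ subst (λ z → SameDart z y) (r0r2-comm x))
            (edge-orbit⇒sameDart xs)

  vertEdgeInc⇔ends : ∀ {x e v} → edge x ≡ e →
                     VertEdgeInc v e ⇔ (v ≡ vert x ⊎ v ≡ vert (r0 x))
  vertEdgeInc⇔ends {x} {e} {v} edge-x≡e = mk⇔ to from
    where
    to : VertEdgeInc v e → v ≡ vert x ⊎ v ≡ vert (r0 x)
    to (y , vert-y≡v , edge-y≡e) =
      Sum.map (trans (sym vert-y≡v) ∘ sameDart⇒vert≡) (trans (sym vert-y≡v) ∘ sameDart⇒vert≡)
        (edge-orbit⇒sameDart (Equivalence.to (edge-orbit x y) (trans edge-x≡e (sym edge-y≡e))))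
    from : v ≡ vert x ⊎ v ≡ vert (r0 x) → VertEdgeInc v e
    from (inj₁ v≡vert-x)    = x , sym v≡vert-x , edge-x≡e
    from (inj₂ v≡vert-r0-x) = r0 x , sym v≡vert-r0-x , trans (edge-r0 x) edge-x≡e

  ∑-valency : NoLoops M → ∑[ v < nV ] valency v ≡ 2 * nE
  ∑-valency noLoops =
    handshake (λ v e → any? (λ x → (vert x ≟ v) ×-dec (edge x ≟ e)))
      (vert ∘ flagOn) (vert ∘ r0 ∘ flagOn) (noLoops ∘ flagOn)
      (λ v e → vertEdgeInc⇔ends (proj₂ (edge-surj e)))
    where
    flagOn : Fin nE → Fin nFlags
    flagOn e = proj₁ (edge-surj e)

  nE≡0⇒nV≡0 : nE ≡ 0 → nV ≡ 0
  nE≡0⇒nV≡0 nE≡0 = Fin→Fin0⇒≡0 (λ v → subst Fin nE≡0 (edge (proj₁ (vert-surj v))))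
    where
    Fin→Fin0⇒≡0 : ∀ {n} → (Fin n → Fin 0) → n ≡ 0
    Fin→Fin0⇒≡0 {zero}  _ = refl
    Fin→Fin0⇒≡0 {suc n} f with f zero
    ... | ()

-- valency (dual M) is faceLength and NoLoops (dual M) is EdgesTwoFaces M, definitionally.
∑-faceLength : (M : Map) → EdgesTwoFaces M →
               ∑[ f < Map.nF M ] Map.faceLength M f ≡ 2 * Map.nE M
∑-faceLength M = ∑-valency (dual M)

nE≡0⇒nF≡0 : (M : Map) → Map.nE M ≡ 0 → Map.nF M ≡ 0
nE≡0⇒nF≡0 M = nE≡0⇒nV≡0 (dual M)

gcd[χ,nE]≡1⇒nE≢0 : (M : Map) → gcd (Map.χ M) (+ Map.nE M) ≡ + 1 → NonZero (Map.nE M)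
gcd[χ,nE]≡1⇒nE≢0 M gcd≡1 =
  ≢-nonZero λ nE≡0 → contradiction (trans (sym (gcd[χ,nE]≡0 nE≡0)) gcd≡1) λ ()
  where
  open Map M
  gcd[χ,nE]≡0 : nE ≡ 0 → gcd χ (+ nE) ≡ + 0
  gcd[χ,nE]≡0 nE≡0 = trans (cong₂ gcd χ≡0 (cong +_ nE≡0)) gcd[0,0]≡0
    where
    χ≡0 : χ ≡ + 0
    χ≡0 = cong₂ ℤ._+_ (cong₂ ℤ._-_ (cong +_ (nE≡0⇒nV≡0 M nE≡0)) (cong +_ nE≡0))
                      (cong +_ (nE≡0⇒nF≡0 M nE≡0))

gcd[v-e+f,e]≡1⇒e∣k*ℓ : ∀ {v e f k ℓ} → v * ℓ ≡ 2 * e → f * k ≡ 2 * e →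
                         gcd ((+ v ℤ.- + e) ℤ.+ + f) (+ e) ≡ + 1 → e ∣ k * ℓ
gcd[v-e+f,e]≡1⇒e∣k*ℓ {v} {e} {f} {k} {ℓ} vℓ≡2e fk≡2e gcd≡1 =
  coprime-divisor (+ e) χ (+ (k * ℓ)) e⊥χ e∣χkℓ
  where
  χ w : ℤ.ℤ
  χ = (+ v ℤ.- + e) ℤ.+ + f
  w = (+ 2 ℤ.* + k ℤ.+ + 2 ℤ.* + ℓ) ℤ.- + k ℤ.* + ℓ
  lift : ∀ m n d → m * n ≡ 2 * d → + m ℤ.* + n ≡ + 2 ℤ.* + d
  lift m n d mn≡2d = trans (sym (pos-* m n)) (trans (cong +_ mn≡2d) (pos-* 2 d))
  χkℓ≡ew : χ ℤ.* (+ k ℤ.* + ℓ) ≡ + e ℤ.* w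
  χkℓ≡ew = [v-e+f]*[k*l]≡e*[2k+2l-k*l] (+ v) (+ e) (+ f) (+ k) (+ ℓ)
             (lift v ℓ e vℓ≡2e) (lift f k e fk≡2e)
  e⊥χ : Coprime (+ e) χ
  e⊥χ = gcd≡1⇒coprime (+-injective (trans (gcd-comm (+ e) χ) gcd≡1))
  e∣χkℓ : e ∣ ∣ χ ℤ.* + (k * ℓ) ∣
  e∣χkℓ = begin
    e                        ∣⟨ m∣m*n ∣ w ∣ ⟩
    e * ∣ w ∣                ≡⟨ abs-* (+ e) w ⟨
    ∣ + e ℤ.* w ∣            ≡⟨ cong ∣_∣ χkℓ≡ew ⟨
    ∣ χ ℤ.* (+ k ℤ.* + ℓ) ∣  ≡⟨ cong (λ kℓ → ∣ χ ℤ.* kℓ ∣) (pos-* k ℓ) ⟨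
    ∣ χ ℤ.* + (k * ℓ) ∣      ∎
    where open ∣-Reasoning

m*n≡2*e⇒e∣k*n⇒m∣2*k : ∀ {m n e} k .{{_ : NonZero e}} →
                       m * n ≡ 2 * e → e ∣ k * n → m ∣ 2 * k
m*n≡2*e⇒e∣k*n⇒m∣2*k {m} {n} {e} k mn≡2e e∣kn = *-cancelʳ-∣ n {{n≢0}} (begin
  m * n        ≡⟨ mn≡2e ⟩
  2 * e        ∣⟨ *-monoʳ-∣ 2 e∣kn ⟩
  2 * (k * n)  ≡⟨ *-assoc 2 k n ⟨
  2 * k * n    ∎)
  where
  open ∣-Reasoning
  n≢0 : NonZero n
  n≢0 = m*n≢0⇒n≢0 m {{subst NonZero (sym mn≡2e) (m*n≢0 2 e)}}

lemma3p1 : (M : Map) → NoLoops M → EdgesTwoFaces M → (k ℓ : ℕ)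
    → (∀ v → Map.valency M v ≡ ℓ) → (∀ f → Map.faceLength M f ≡ k)
    → gcd (Map.χ M) (+ Map.nE M) ≡ + 1
    → (Map.nE M ∣ k * ℓ) × (Map.nV M ∣ 2 * k) × (Map.nF M ∣ 2 * ℓ)
lemma3p1 M noLoops twoFaces k ℓ valency≡ℓ faceLength≡k gcd≡1 =
  nE∣kℓ ,
  m*n≡2*e⇒e∣k*n⇒m∣2*k k nVℓ≡2nE nE∣kℓ ,
  m*n≡2*e⇒e∣k*n⇒m∣2*k ℓ nFk≡2nE (subst (nE ∣_) (*-comm k ℓ) nE∣kℓ)
  where
  open Map M
  instance
    nE≢0 : NonZero nE
    nE≢0 = gcd[χ,nE]≡1⇒nE≢0 M gcd≡1
  nVℓ≡2nE : nV * ℓ ≡ 2 * nE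
  nVℓ≡2nE = ∑-regular valency valency≡ℓ (∑-valency M noLoops)
  nFk≡2nE : nF * k ≡ 2 * nE
  nFk≡2nE = ∑-regular faceLength faceLength≡k (∑-faceLength M twoFaces)
  nE∣kℓ : nE ∣ k * ℓ
  nE∣kℓ = gcd[v-e+f,e]≡1⇒e∣k*ℓ nVℓ≡2nE nFk≡2nE gcd≡1
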